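{- Let $k$ be a positive integer and $n\ge 2k$. Let $\mathcal{A}_1=2^{[k]}\setminus\{\emptyset\}$, $\mathcal{A}_2=2^{\{k+1,\dots,2k-1\}}\setminus\{\emptyset\}$, $\mathcal{A}_{1,2}=\{[k]\cup A: A\in\mathcal{A}_2\}$, and for a family $\mathcal{H}$ write $\mathcal{H}^c=\{[n]\setminus H: H\in\mathcal{H}\}$. Then: (1) $\mathbb{B}_{k,- }$ is $(C_k+C_1)$-free, and thus $2\mathbb{B}_{k,- }$ is $(2C_k+C_1)$-free; (2) $\mathbb{B}_{k+1,-,- }$ is $(2C_k+C_1)$-free; (3) $\mathcal{A}_1=\mathbb{B}_{k,- }$, $\mathcal{A}_2=\mathbb{B}_{k-1,- }$, and $\mathcal{A}_1\cup\mathcal{A}_1^c=\mathbb{B}_{k+1,-,- }$; (4) $\mathcal{A}_2\cup\mathcal{A}_{1,2}\cup\mathcal{A}_2^c\cup\mathcal{A}_{1,2}^c\leqslant\mathbb{B}_{k+1,-,- }$; (5) $\mathcal{A}_2\cup\mathcal{A}_{1,2}^c=\mathbb{B}_{k,-,- }$.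
   Context: $[n]=\{1,\dots,n\}$. $\mathbb{B}_{k,- }$ is the poset $2^{[k]}\setminus\{\emptyset\}$ and $\mathbb{B}_{k,-,- }$ is the poset $2^{[k]}\setminus\{\emptyset,[k]\}$, both ordered by inclusion. For a family $\mathcal{G}$ of sets and a poset $P$, $\mathcal{G}\leqslant P$ means that the poset on $\mathcal{G}$ ordered by inclusion has a (induced) copy in $P$, i.e. is isomorphic to a subposet of $P$ with the induced order, and $\mathcal{G}=P$ means this poset is isomorphic to $P$. A poset $Q$ is $P$-free if it has no induced copy of $P$, i.e. no subset which with the induced order is isomorphic to $P$. $C_k$ denotes the $k$-element chain, $P+P'$ the disjoint union of posets with no element of one comparable to an element of the other, and $2P=P+P$. -}

module Defs where

open import Level using (0ℓ)
open import Data.Nat using (ℕ; zero; suc; _≤_; _<_; _≤ᵇ_; _*_; _∸_)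
open import Data.Bool using (_∧_)
open import Data.Fin using (Fin; toℕ)
open import Data.Fin.Subset using (Subset; _⊆_; _∪_; ∁; ⊤; Nonempty)
open import Data.Vec using (tabulate)
open import Data.Product using (Σ; ∃; _×_; proj₁; _,_)
open import Data.Sum using (_⊎_)
open import Relation.Nullary using (¬_)
open import Relation.Binary.PropositionalEquality using (_≡_)
open import Relation.Binary.Bundles using (Poset)
open import Function.Bundles using (_⇔_)
import Relation.Binary.Construct.On as On
import Data.Fin.Properties as FinP
import Data.Fin.Subset.Properties as SubP
import Data.Sum.Relation.Binary.Pointwise as SumPW

Pos : Set₁
Pos = Poset 0ℓ 0ℓ 0ℓ

-- Q ≤ P : P has an induced copy of Q, i.e. an order embedding Q → P
-- (x ≤ y iff f x ≤ f y; injectivity up to ≈ follows by antisymmetry).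
_≼_ : Pos → Pos → Set
Q ≼ P = Σ (Poset.Carrier Q → Poset.Carrier P) λ f →
  ∀ x y → (Poset._≤_ Q x y ⇔ Poset._≤_ P (f x) (f y))

_≅_ : Pos → Pos → Set
Q ≅ P = Σ (Poset.Carrier Q → Poset.Carrier P) λ f →
  (∀ x y → (Poset._≤_ Q x y ⇔ Poset._≤_ P (f x) (f y))) ×
  (∀ p → ∃ λ q → Poset._≈_ P (f q) p)

Free : Pos → Pos → Set
Free Q P = ¬ (Q ≼ P)

Family : ℕ → Set₁
Family n = Subset n → Set

FamPoset : ∀ {n} → Family n → Pos
FamPoset {n} F = On.poset (SubP.⊆-poset n) (proj₁ {B = F})

Chain : ℕ → Pos
Chain k = FinP.≤-poset k

_⊕_ : Pos → Pos → Pos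
P ⊕ P' = SumPW.⊎-poset P P'

twice : Pos → Pos
twice P = P ⊕ P

B₋ : ℕ → Pos
B₋ k = FamPoset {k} λ A → Nonempty A

B₋₋ : ℕ → Pos
B₋₋ k = FamPoset {k} λ A → Nonempty A × ¬ (A ≡ ⊤)

-- the integer interval {a,...,b} as a subset of [n] (elements 1-indexed:
-- the element i : Fin n stands for the integer toℕ i + 1)
Iv : (n a b : ℕ) → Subset n
Iv n a b = tabulate λ (i : Fin n) → (a ≤ᵇ suc (toℕ i)) ∧ (suc (toℕ i) ≤ᵇ b)

𝒜₁ : (n k : ℕ) → Family n
𝒜₁ n k A = Nonempty A × A ⊆ Iv n 1 k

𝒜₂ : (n k : ℕ) → Family n
𝒜₂ n k A = Nonempty A × A ⊆ Iv n (suc k) (2 * k ∸ 1)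

𝒜₁₂ : (n k : ℕ) → Family n
𝒜₁₂ n k B = ∃ λ A → 𝒜₂ n k A × B ≡ Iv n 1 k ∪ A

_ᶜ : ∀ {n} → Family n → Family n
(ℋ ᶜ) B = ∃ λ H → ℋ H × B ≡ ∁ H

_∪F_ : ∀ {n} → Family n → Family n → Family n
(F ∪F G) A = F A ⊎ G A
infixl 6 _∪F_

-- A chain C_k of nonempty subsets of [k] gains at least one element per step, so its top is [k],
-- which lies above every set: nothing is incomparable to it.  In 2B_{k,-} two of the three maximal
-- elements of 2C_k + C_1 fall into the same copy, and one of those two is a chain top, hence above
-- the other.  In B_{k+1,-,-} the same count makes a C_k run from a singleton to the complement of a
-- point x; an element incomparable to the top of the first chain contains x, and so does the
-- singleton at the bottom of the second chain, which is therefore below it.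
-- For (3)-(5) cut [n] into the blocks [1,k], [k+1,2k-1], [2k,n].  Every member of the families is
-- constant on all blocks but one; recording the free block and one bit per constant block whose
-- value varies across the family is an order embedding into B_{k+1,-,-} in (4), and an isomorphism
-- onto B_{k,-}, B_{k-1,-}, B_{k+1,-,-} and B_{k,-,-} in (3) and (5).

module Submission where

open import Defs
open import Data.Nat using (ℕ; zero; suc; _+_; _*_; _∸_; _≤_; _<_; _≤ᵇ_; _≤?_; s≤s)
open import Data.Nat.Properties
  using (≤-refl; ≤-trans; ≤-antisym; ≤-pred; <⇒≤; <⇒≱; ≤∧≢⇒<; ≤⇒≤ᵇ; m≤m+n; +-comm; +-monoʳ-<; +-monoʳ-≤;
         +-monoˡ-≤; +-cancelʳ-≤; ∸-monoʳ-≤; m+n∸n≡m; m≤n⇒∃[o]m+o≡n; module ≤-Reasoning)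
open import Data.Nat.Tactic.RingSolver using (solve-∀)
import Data.Bool.Base as Bool
open Bool using (Bool; true; false; _∧_; f≤t; b≤b)
open import Data.Bool.Properties using (T-≡; ∧-zeroʳ; ≤-minimum; not-involutive)
open import Data.Fin using (Fin; zero; suc; toℕ; fromℕ; inject₁; _↑ˡ_; _↑ʳ_; _≟_)
open import Data.Fin.Properties using (toℕ<n; toℕ-↑ˡ; toℕ-↑ʳ; toℕ-fromℕ; ≤̄⇒inject₁<; ¬∀⟶∃¬)
  renaming (≤-refl to ≤ᶠ-refl)
open import Data.Fin.Subset
  using (Subset; inside; outside; _∈_; _∉_; _⊆_; _⊂_; _∪_; ∁; ⊤; ⊥; ⁅_⁆; ∣_∣; Nonempty; Empty)
open import Data.Fin.Subset.Properties
  using (drop-∷-⊆; out⊆; s⊆s; ⊆-refl; ⊆-reflexive; ⊆-antisym; ⊥⊆; ⊆⊤; ∉⊥; _∈?_; nonempty?; Empty-unique;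
         x∈p⇒x∉∁p; x∉p⇒x∈∁p; x∈⁅y⁆⇒x≡y; ∣⁅x⁆∣≡1; ∣p∣≤n; ∣p∣≡n⇒p≡⊤; p⊆q⇒∣p∣≤∣q∣; p⊂q⇒∣p∣<∣q∣;
         ∣∁p∣≡n∸∣p∣; ∪-identityˡ; ∪-zeroˡ)
open import Data.Vec using ([]; _∷_; here; there; _++_; replicate; tabulate; splitAt)
open import Data.Vec.Properties
  using (map-++; map-replicate; map-∘; map-cong; map-id; zipWith-++; ∷-injectiveʳ)
open import Data.Vec.Relation.Binary.Pointwise.Inductive using (Pointwise; []; _∷_; ++⁺; ++⁻)
open import Data.Product using (Σ; ∃; ∃₂; _×_; _,_; proj₁; proj₂; map₂)
open import Data.Sum using (_⊎_; inj₁; inj₂; [_,_]′)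
import Data.Sum as Sum
import Data.Sum.Relation.Binary.Pointwise as ⊎
open ⊎ using (drop-inj₁; drop-inj₂)
open import Data.Empty using (⊥-elim)
open import Function using (_∘_; id; const; case_of_)
open import Function.Bundles using (_⇔_; mk⇔; Equivalence)
open import Function.Construct.Composition using (_⇔-∘_)
open import Function.Construct.Symmetry using (⇔-sym)
open import Relation.Nullary using (¬_; yes; no; contradiction)
open import Relation.Nullary.Decidable using (dec-false; decidable-stable; _→-dec_)
open import Relation.Unary using (_≐_) renaming (_⊆_ to _⊆ᶠ_)
open import Relation.Binary.Bundles using (Poset)
open import Relation.Binary.PropositionalEquality
  using (_≡_; _≢_; refl; sym; trans; cong; cong₂; subst; module ≡-Reasoning)

open Equivalence using (to; from)

private
  variable
    j m n : ℕ
    a b : Bool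
    p q : Subset n

⊆⇒≤* : p ⊆ q → Pointwise Bool._≤_ p q
⊆⇒≤* {p = []}          {[]}          _   = []
⊆⇒≤* {p = outside ∷ p} {s ∷ q}       p⊆q = ≤-minimum s ∷ ⊆⇒≤* (drop-∷-⊆ p⊆q)
⊆⇒≤* {p = inside ∷ p}  {inside ∷ q}  p⊆q = b≤b ∷ ⊆⇒≤* (drop-∷-⊆ p⊆q)
⊆⇒≤* {p = inside ∷ p}  {outside ∷ q} p⊆q with p⊆q here
... | ()

≤*⇒⊆ : Pointwise Bool._≤_ p q → p ⊆ q
≤*⇒⊆ []            {()}
≤*⇒⊆ (f≤t ∷ p≤q)   = out⊆ (≤*⇒⊆ p≤q)
≤*⇒⊆ (b≤b ∷ p≤q)   = s⊆s (≤*⇒⊆ p≤q)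

++-⊆⇔ : ∀ {p p′ : Subset m} {q q′ : Subset n} → p ++ q ⊆ p′ ++ q′ ⇔ (p ⊆ p′ × q ⊆ q′)
++-⊆⇔ {p = p} {p′} {q} {q′} = mk⇔ split join
  where
  split : p ++ q ⊆ p′ ++ q′ → p ⊆ p′ × q ⊆ q′
  split pq⊆ = let p≤ , q≤ = ++⁻ p p′ (⊆⇒≤* pq⊆) in ≤*⇒⊆ p≤ , ≤*⇒⊆ q≤
  join : p ⊆ p′ × q ⊆ q′ → p ++ q ⊆ p′ ++ q′
  join (p⊆ , q⊆) = ≤*⇒⊆ (++⁺ (⊆⇒≤* p⊆) (⊆⇒≤* q⊆))

∷-⊆⇔ : a ∷ p ⊆ b ∷ q ⇔ (a Bool.≤ b × p ⊆ q)
∷-⊆⇔ {a = a} {p = p} {b} {q} = mk⇔ split join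
  where
  split : a ∷ p ⊆ b ∷ q → a Bool.≤ b × p ⊆ q
  split ap⊆bq with ⊆⇒≤* ap⊆bq
  ... | a≤b ∷ p≤q = a≤b , ≤*⇒⊆ p≤q
  join : a Bool.≤ b × p ⊆ q → a ∷ p ⊆ b ∷ q
  join (a≤b , p⊆q) = ≤*⇒⊆ (a≤b ∷ ⊆⇒≤* p⊆q)

replicate-⊆ : a Bool.≤ b → replicate n a ⊆ replicate n b
replicate-⊆ f≤t = ⊥⊆
replicate-⊆ b≤b = ⊆-refl

⊈⇒∃∉ : ¬ p ⊆ q → ∃ λ x → x ∈ p × x ∉ q
⊈⇒∃∉ {n} {p} {q} p⊈q with ¬∀⟶∃¬ n (λ x → x ∈ p → x ∈ q) (λ x → x ∈? p →-dec x ∈? q) (λ p⊆q → p⊈q (p⊆q _))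
... | x , x∈p↛x∈q = x , decidable-stable (x ∈? p) (λ x∉p → x∈p↛x∈q (⊥-elim ∘ x∉p)) , x∈p↛x∈q ∘ const

∈⇒⁅⁆⊆ : ∀ {x} → x ∈ p → ⁅ x ⁆ ⊆ p
∈⇒⁅⁆⊆ {p = p} {x} x∈p y∈⁅x⁆ = subst (_∈ p) (sym (x∈⁅y⁆⇒x≡y x y∈⁅x⁆)) x∈p

Nonempty⇒1≤∣∣ : Nonempty p → 1 ≤ ∣ p ∣
Nonempty⇒1≤∣∣ {p = p} (x , x∈p) = subst (_≤ ∣ p ∣) (∣⁅x⁆∣≡1 x) (p⊆q⇒∣p∣≤∣q∣ (∈⇒⁅⁆⊆ x∈p))

∣∣≤1⇒≡ : ∀ {p : Subset n} {x y} → ∣ p ∣ ≤ 1 → x ∈ p → y ∈ p → x ≡ y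
∣∣≤1⇒≡ {p = p} {x} {y} ∣p∣≤1 x∈p y∈p with x ≟ y
... | yes x≡y = x≡y
... | no x≢y  = contradiction ∣p∣≤1 (<⇒≱ (subst (_< ∣ p ∣) (∣⁅x⁆∣≡1 x) (p⊂q⇒∣p∣<∣q∣ ⁅x⁆⊂p)))
  where
  ⁅x⁆⊂p : ⁅ x ⁆ ⊂ p
  ⁅x⁆⊂p = ∈⇒⁅⁆⊆ x∈p , y , y∈p , x≢y ∘ sym ∘ x∈⁅y⁆⇒x≡y x

n≤∣p∣⇒p≡⊤ : {p : Subset n} → n ≤ ∣ p ∣ → p ≡ ⊤
n≤∣p∣⇒p≡⊤ {p = p} n≤∣p∣ = ∣p∣≡n⇒p≡⊤ (≤-antisym (∣p∣≤n p) n≤∣p∣)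

∁-involutive : (p : Subset n) → ∁ (∁ p) ≡ p
∁-involutive p = trans (sym (map-∘ Bool.not Bool.not p)) (trans (map-cong not-involutive p) (map-id p))

∁⊥≡⊤ : ∁ (⊥ {n}) ≡ ⊤
∁⊥≡⊤ {n} = map-replicate Bool.not false n

∁⊤≡⊥ : ∁ (⊤ {n}) ≡ ⊥
∁⊤≡⊥ {n} = map-replicate Bool.not true n

Nonempty⇒∁≢⊤ : Nonempty p → ∁ p ≢ ⊤
Nonempty⇒∁≢⊤ (x , x∈p) ∁p≡⊤ = x∈p⇒x∉∁p x∈p (subst (x ∈_) (sym ∁p≡⊤) (⊆⊤ x∈p))

≢⊤⇒Nonempty∁ : p ≢ ⊤ → Nonempty (∁ p)
≢⊤⇒Nonempty∁ {p = p} p≢⊤ with nonempty? (∁ p)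
... | yes ∁p≢∅ = ∁p≢∅
... | no ∁p≡∅  = contradiction p≡⊤ p≢⊤
  where
  open ≡-Reasoning
  p≡⊤ : p ≡ ⊤
  p≡⊤ = begin
    p        ≡⟨ ∁-involutive p ⟨
    ∁ (∁ p)  ≡⟨ cong ∁ (Empty-unique ∁p≡∅) ⟩
    ∁ ⊥      ≡⟨ ∁⊥≡⊤ ⟩
    ⊤        ∎

Nonempty-++⁻ : (p : Subset m) → Nonempty (p ++ q) → Nonempty p ⊎ Nonempty q
Nonempty-++⁻ []            pq≢∅                  = inj₂ pq≢∅
Nonempty-++⁻ (inside ∷ p)  _                     = inj₁ (zero , here)
Nonempty-++⁻ (outside ∷ p) (suc x , there x∈pq) with Nonempty-++⁻ p (x , x∈pq)
... | inj₁ (y , y∈p) = inj₁ (suc y , there y∈p)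
... | inj₂ q≢∅       = inj₂ q≢∅

Nonempty-++ˡ : Nonempty p → Nonempty (p ++ q)
Nonempty-++ˡ (zero , here)        = zero , here
Nonempty-++ˡ (suc x , there x∈p) = let y , y∈pq = Nonempty-++ˡ (x , x∈p) in suc y , there y∈pq

Nonempty-++ʳ : (p : Subset m) → Nonempty q → Nonempty (p ++ q)
Nonempty-++ʳ []      q≢∅ = q≢∅
Nonempty-++ʳ (_ ∷ p) q≢∅ = let y , y∈pq = Nonempty-++ʳ p q≢∅ in suc y , there y∈pq

Empty-⊥ : Empty (⊥ {n})
Empty-⊥ (_ , x∈⊥) = ∉⊥ x∈⊥

⊆⊥⇒≡⊥ : p ⊆ ⊥ → p ≡ ⊥
⊆⊥⇒≡⊥ p⊆⊥ = ⊆-antisym p⊆⊥ ⊥⊆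

IsOrderEmbedding : (Subset m → Subset n) → Set
IsOrderEmbedding e = ∀ {p q} → p ⊆ q ⇔ e p ⊆ e q

∷-isOrderEmbedding : ∀ s → IsOrderEmbedding {n} (s ∷_)
∷-isOrderEmbedding s = mk⇔ s⊆s drop-∷-⊆

∘-isOrderEmbedding : ∀ {l} {e : Subset m → Subset n} {e′ : Subset l → Subset m} →
                     IsOrderEmbedding e → IsOrderEmbedding e′ → IsOrderEmbedding (e ∘ e′)
∘-isOrderEmbedding e-emb e′-emb = e-emb ⇔-∘ e′-emb

isOrderEmbedding⇒injective : {e : Subset m → Subset n} → IsOrderEmbedding e → ∀ {p q} → e p ≡ e q → p ≡ q
isOrderEmbedding⇒injective e-emb ep≡eq =
  ⊆-antisym (from e-emb (⊆-reflexive ep≡eq)) (from e-emb (⊆-reflexive (sym ep≡eq)))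

Image : (Subset m → Subset n) → Family m → Family n
Image e G A = ∃ λ p → G p × A ≡ e p

module _ {F : Family n} {G : Family m} {e : Subset m → Subset n} (e-emb : IsOrderEmbedding e) where

  Image-≼ : F ⊆ᶠ Image e G → FamPoset F ≼ FamPoset G
  Image-≼ F⊆eG = preimage , preimage-≤⇔
    where
    preimage : Σ (Subset n) F → Σ (Subset m) G
    preimage (_ , A∈F) = let p , p∈G , _ = F⊆eG A∈F in p , p∈G
    preimage-≤⇔ : ∀ A B → proj₁ A ⊆ proj₁ B ⇔ proj₁ (preimage A) ⊆ proj₁ (preimage B)
    preimage-≤⇔ (_ , A∈F) (_ , B∈F) with F⊆eG A∈F | F⊆eG B∈F
    ... | _ , _ , refl | _ , _ , refl = ⇔-sym e-emb

  Image-≅ : F ≐ Image e G → FamPoset F ≅ FamPoset G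
  Image-≅ (F⊆eG , eG⊆F) = preimage , preimage-≤⇔ , preimage-surjective
    where
    open Σ (Image-≼ F⊆eG) renaming (proj₁ to preimage; proj₂ to preimage-≤⇔)
    preimage-surjective : ∀ P → ∃ λ A → proj₁ (preimage A) ≡ proj₁ P
    preimage-surjective (p , p∈G) =
      (e p , eG⊆F (p , p∈G , refl)) , sym (isOrderEmbedding⇒injective e-emb (proj₂ (proj₂ (F⊆eG _))))

Proper : Family n
Proper A = Nonempty A × A ≢ ⊤

outside∷-Proper⇔ : Proper (outside ∷ p) ⇔ Nonempty p
outside∷-Proper⇔ = mk⇔ (λ { ((suc x , there x∈p) , _) → x , x∈p })
                       (λ { (x , x∈p) → (suc x , there x∈p) , λ () })

inside∷-Proper⇔ : Proper (inside ∷ p) ⇔ p ≢ ⊤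
inside∷-Proper⇔ = mk⇔ (λ (_ , p≢⊤) → p≢⊤ ∘ cong (inside ∷_)) (λ p≢⊤ → (zero , here) , p≢⊤ ∘ ∷-injectiveʳ)

Proper-∷ : ∀ s → Proper p → Proper (s ∷ p)
Proper-∷ outside (p≢∅ , _) = from outside∷-Proper⇔ p≢∅
Proper-∷ inside  (_ , p≢⊤) = from inside∷-Proper⇔ p≢⊤

ᶜ-Image : {F : Family n} {e e′ : Subset m → Subset n} →
          (∀ p → ∁ (e p) ≡ e′ (∁ p)) → F ≐ Image e Nonempty → F ᶜ ≐ Image e′ (_≢ ⊤)
ᶜ-Image {F = F} {e} {e′} ∁e≡e′∁ (F⊆eN , eN⊆F) = Fᶜ⊆ , ⊆Fᶜ
  where
  Fᶜ⊆ : F ᶜ ⊆ᶠ Image e′ (_≢ ⊤)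
  Fᶜ⊆ (_ , H∈F , refl) with F⊆eN H∈F
  ... | p , p≢∅ , refl = ∁ p , Nonempty⇒∁≢⊤ p≢∅ , ∁e≡e′∁ p
  ⊆Fᶜ : Image e′ (_≢ ⊤) ⊆ᶠ F ᶜ
  ⊆Fᶜ (q , q≢⊤ , refl) = e (∁ q) , eN⊆F (∁ q , ≢⊤⇒Nonempty∁ q≢⊤ , refl) , (begin
    e′ q           ≡⟨ cong e′ (∁-involutive q) ⟨
    e′ (∁ (∁ q))   ≡⟨ ∁e≡e′∁ (∁ q) ⟨
    ∁ (e (∁ q))    ∎)
    where open ≡-Reasoning

∪-Image-Proper : {F G : Family n} {e : Subset (suc m) → Subset n} →
                 F ≐ Image (e ∘ (outside ∷_)) Nonempty → G ≐ Image (e ∘ (inside ∷_)) (_≢ ⊤) →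
                 F ∪F G ≐ Image e Proper
∪-Image-Proper {F = F} {G} {e} (F⊆ , ⊆F) (G⊆ , ⊆G) = F∪G⊆ , ⊆F∪G
  where
  F∪G⊆ : F ∪F G ⊆ᶠ Image e Proper
  F∪G⊆ (inj₁ A∈F) = let p , p≢∅ , A≡ = F⊆ A∈F in outside ∷ p , from outside∷-Proper⇔ p≢∅ , A≡
  F∪G⊆ (inj₂ A∈G) = let p , p≢⊤ , A≡ = G⊆ A∈G in inside ∷ p , from inside∷-Proper⇔ p≢⊤ , A≡
  ⊆F∪G : Image e Proper ⊆ᶠ F ∪F G
  ⊆F∪G (outside ∷ p , proper , refl) = inj₁ (⊆F (p , to outside∷-Proper⇔ proper , refl))
  ⊆F∪G (inside ∷ p  , proper , refl) = inj₂ (⊆G (p , to inside∷-Proper⇔ proper , refl))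

Image-∷-Proper : ∀ {e : Subset (suc m) → Subset n} s → Image (e ∘ (s ∷_)) Proper ⊆ᶠ Image e Proper
Image-∷-Proper s (p , proper , A≡) = s ∷ p , Proper-∷ s proper , A≡

tabulate-++ : ∀ {A : Set} m {n} (f : Fin (m + n) → A) →
              tabulate f ≡ tabulate (f ∘ (_↑ˡ n)) ++ tabulate (f ∘ (m ↑ʳ_))
tabulate-++ zero    f = refl
tabulate-++ (suc m) f = cong (f zero ∷_) (tabulate-++ m (f ∘ suc))

tabulate-const : ∀ {A : Set} {f : Fin n → A} {x} → (∀ i → f i ≡ x) → tabulate f ≡ replicate n x
tabulate-const {zero}  _   = refl
tabulate-const {suc n} f≗x = cong₂ _∷_ (f≗x zero) (tabulate-const (f≗x ∘ suc))

replicate-++ : ∀ {A : Set} m {n} (x : A) → replicate (m + n) x ≡ replicate m x ++ replicate n x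
replicate-++ zero    x = refl
replicate-++ (suc m) x = cong (x ∷_) (replicate-++ m x)

≤ᵇ-true : ∀ {m n} → m ≤ n → (m ≤ᵇ n) ≡ true
≤ᵇ-true = to T-≡ ∘ ≤⇒≤ᵇ

≤ᵇ-false : ∀ {m n} → ¬ m ≤ n → (m ≤ᵇ n) ≡ false
≤ᵇ-false {m} {n} = dec-false (m ≤? n)   -- does (m ≤? n) computes to m ≤ᵇ n

Iv-block : ∀ a b c → Iv (a + (b + c)) (suc a) (a + b) ≡ ⊥ {a} ++ (⊤ {b} ++ ⊥ {c})
Iv-block a b c =
  trans (tabulate-++ a f) (cong₂ _++_ (tabulate-const before)
    (trans (tabulate-++ b (f ∘ (a ↑ʳ_))) (cong₂ _++_ (tabulate-const within) (tabulate-const after))))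
  where
  inIv : ℕ → Bool
  inIv x = (suc a ≤ᵇ x) ∧ (x ≤ᵇ a + b)
  f : Fin (a + (b + c)) → Bool
  f i = inIv (suc (toℕ i))
  before : ∀ (i : Fin a) → f (i ↑ˡ (b + c)) ≡ false
  before i rewrite toℕ-↑ˡ i (b + c) =
    cong (_∧ (suc (toℕ i) ≤ᵇ a + b)) (≤ᵇ-false (<⇒≱ (s≤s (toℕ<n i))))
  within : ∀ (i : Fin b) → f (a ↑ʳ (i ↑ˡ c)) ≡ true
  within i rewrite toℕ-↑ʳ a (i ↑ˡ c) | toℕ-↑ˡ i c =
    cong₂ _∧_ (≤ᵇ-true (s≤s (m≤m+n a _))) (≤ᵇ-true (+-monoʳ-< a (toℕ<n i)))
  after : ∀ (i : Fin c) → f (a ↑ʳ (b ↑ʳ i)) ≡ false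
  after i rewrite toℕ-↑ʳ a (b ↑ʳ i) | toℕ-↑ʳ b i =
    trans (cong ((suc a ≤ᵇ suc (a + (b + toℕ i))) ∧_) (≤ᵇ-false (<⇒≱ (s≤s (+-monoʳ-≤ a (m≤m+n b _))))))
          (∧-zeroʳ _)

toℕ+f₀≤f : (f : Fin (suc j) → ℕ) → (∀ i → f (inject₁ i) < f (suc i)) → ∀ i → toℕ i + f zero ≤ f i
toℕ+f₀≤f         f f↑ zero    = ≤-refl
toℕ+f₀≤f {suc j} f f↑ (suc i) = ≤-trans (s≤s (toℕ+f₀≤f (f ∘ inject₁) (f↑ ∘ inject₁) i)) (f↑ i)

record StrictlyMonotone (Q : Pos) (set : Poset.Carrier Q → Subset n) : Set where
  constructor strictlyMonotone
  field
    strict : ∀ {u v} → Poset._≤_ Q u v → ¬ Poset._≤_ Q v u → set u ⊂ set v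

proj₁-strictlyMonotone : (F : Family n) → StrictlyMonotone (FamPoset F) proj₁
proj₁-strictlyMonotone _ = strictlyMonotone λ p⊆q q⊈p → p⊆q , ⊈⇒∃∉ q⊈p

module _ {Q : Pos} {set : Poset.Carrier Q → Subset n} (set-mono : StrictlyMonotone Q set) where

  open StrictlyMonotone set-mono

  chain-∣∣ : (c : Chain (suc j) ≼ Q) → ∣ set (proj₁ c zero) ∣ + j ≤ ∣ set (proj₁ c (fromℕ j)) ∣
  chain-∣∣ {j} (c , c-emb) =
    subst (_≤ size (fromℕ j)) (trans (cong (_+ size zero) (toℕ-fromℕ j)) (+-comm j (size zero)))
          (toℕ+f₀≤f size size↑ (fromℕ j))
    where
    size : Fin (suc j) → ℕ
    size = ∣_∣ ∘ set ∘ c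
    size↑ : ∀ i → size (inject₁ i) < size (suc i)
    size↑ i = p⊂q⇒∣p∣<∣q∣ (strict (to (c-emb _ _) (<⇒≤ i<1+i)) (<⇒≱ i<1+i ∘ from (c-emb _ _)))
      where
      i<1+i : toℕ (inject₁ i) < toℕ (suc i)
      i<1+i = ≤̄⇒inject₁< (≤ᶠ-refl {x = i})

chain-top≡⊤ : {Q : Pos} {set : Poset.Carrier Q → Subset (suc j)} → StrictlyMonotone Q set →
              (∀ u → Nonempty (set u)) → (c : Chain (suc j) ≼ Q) → set (proj₁ c (fromℕ j)) ≡ ⊤
chain-top≡⊤ set-mono set≢∅ c =
  n≤∣p∣⇒p≡⊤ (≤-trans (+-monoˡ-≤ _ (Nonempty⇒1≤∣∣ (set≢∅ _))) (chain-∣∣ set-mono c))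

B₋-free : Free (Chain (suc j) ⊕ Chain 1) (B₋ (suc j))
B₋-free {j} (f , f-emb) = case from (f-emb (inj₂ zero) (inj₁ (fromℕ j))) z⊆top of λ ()
  where
  chain : Chain (suc j) ≼ B₋ (suc j)
  chain = f ∘ inj₁ , λ _ _ → f-emb _ _ ⇔-∘ mk⇔ ⊎.inj₁ drop-inj₁
  z⊆top : proj₁ (f (inj₂ zero)) ⊆ proj₁ (f (inj₁ (fromℕ j)))
  z⊆top = subst (proj₁ (f (inj₂ zero)) ⊆_)
                (sym (chain-top≡⊤ (proj₁-strictlyMonotone (Nonempty {suc j})) proj₂ chain)) ⊆⊤

module _ {P : Pos} (emb : ((Chain n ⊕ Chain n) ⊕ Chain 1) ≼ P) where

  open Σ emb renaming (proj₁ to f; proj₂ to f-emb)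

  first-chain : Chain n ≼ P
  first-chain = f ∘ inj₁ ∘ inj₁ , λ _ _ → f-emb _ _ ⇔-∘ mk⇔ (⊎.inj₁ ∘ ⊎.inj₁) (drop-inj₁ ∘ drop-inj₁)

  second-chain : Chain n ≼ P
  second-chain = f ∘ inj₁ ∘ inj₂ , λ _ _ → f-emb _ _ ⇔-∘ mk⇔ (⊎.inj₁ ∘ ⊎.inj₂) (drop-inj₂ ∘ drop-inj₁)

pigeonhole : ∀ (x y z : Bool) → y ≡ x ⊎ z ≡ x ⊎ z ≡ y
pigeonhole false false _     = inj₁ refl
pigeonhole true  true  _     = inj₁ refl
pigeonhole false true  false = inj₂ (inj₁ refl)
pigeonhole true  false true  = inj₂ (inj₁ refl)
pigeonhole false true  true  = inj₂ (inj₂ refl)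
pigeonhole true  false false = inj₂ (inj₂ refl)

module Twice (P : Pos) where

  open Poset (twice P) public using () renaming (Carrier to Carrier²; _≤_ to _≤²_)
  open Poset P using (Carrier) renaming (_≤_ to _≤ᴾ_)

  content : Carrier² → Carrier
  content = [ id , id ]′

  side : Carrier² → Bool
  side = [ const true , const false ]′

  ≤²⇒side≡ : ∀ {u v} → u ≤² v → side u ≡ side v
  ≤²⇒side≡ (⊎.inj₁ _) = refl
  ≤²⇒side≡ (⊎.inj₂ _) = refl

  ≤²⇒content≤ : ∀ {u v} → u ≤² v → content u ≤ᴾ content v
  ≤²⇒content≤ (⊎.inj₁ x≤y) = x≤y
  ≤²⇒content≤ (⊎.inj₂ x≤y) = x≤y

  side≡⇒≤² : ∀ {u v} → side u ≡ side v → content u ≤ᴾ content v → u ≤² v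
  side≡⇒≤² {inj₁ _} {inj₁ _} _ x≤y = ⊎.inj₁ x≤y
  side≡⇒≤² {inj₂ _} {inj₂ _} _ x≤y = ⊎.inj₂ x≤y
  side≡⇒≤² {inj₁ _} {inj₂ _} ()
  side≡⇒≤² {inj₂ _} {inj₁ _} ()

module _ {j : ℕ} where

  open Twice (B₋ (suc j))

  content-strictlyMonotone : StrictlyMonotone (twice (B₋ (suc j))) (proj₁ ∘ content)
  content-strictlyMonotone = strictlyMonotone λ {u} {v} u≤v v≰u →
    StrictlyMonotone.strict (proj₁-strictlyMonotone (Nonempty {suc j})) {content u} {content v}
      (≤²⇒content≤ u≤v) (v≰u ∘ side≡⇒≤² (sym (≤²⇒side≡ u≤v)))

  twice-B₋-chain-top : (c : Chain (suc j) ≼ twice (B₋ (suc j))) →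
                       ∀ u → side u ≡ side (proj₁ c (fromℕ j)) → u ≤² proj₁ c (fromℕ j)
  twice-B₋-chain-top c u same-side = side≡⇒≤² same-side (λ {x} → u⊆top {x})
    where
    u⊆top : proj₁ (content u) ⊆ proj₁ (content (proj₁ c (fromℕ j)))
    u⊆top = subst (proj₁ (content u) ⊆_)
                  (sym (chain-top≡⊤ content-strictlyMonotone (proj₂ ∘ content) c)) ⊆⊤

  twice-B₋-free : Free ((Chain (suc j) ⊕ Chain (suc j)) ⊕ Chain 1) (twice (B₋ (suc j)))
  twice-B₋-free emb@(f , f-emb) = two-on-one-side (pigeonhole (side (f t₁)) (side (f t₂)) (side (f z)))
    where
    t₁ t₂ z : Poset.Carrier ((Chain (suc j) ⊕ Chain (suc j)) ⊕ Chain 1)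
    t₁ = inj₁ (inj₁ (fromℕ j))
    t₂ = inj₁ (inj₂ (fromℕ j))
    z  = inj₂ zero
    c₁ c₂ : Chain (suc j) ≼ twice (B₋ (suc j))
    c₁ = first-chain {P = twice (B₋ (suc j))} emb
    c₂ = second-chain {P = twice (B₋ (suc j))} emb
    two-on-one-side : ¬ (side (f t₂) ≡ side (f t₁) ⊎ side (f z) ≡ side (f t₁) ⊎ side (f z) ≡ side (f t₂))
    two-on-one-side (inj₁ t₂∼t₁) =
      case from (f-emb t₂ t₁) (twice-B₋-chain-top c₁ (f t₂) t₂∼t₁) of λ { (⊎.inj₁ ()) }
    two-on-one-side (inj₂ (inj₁ z∼t₁)) =
      case from (f-emb z t₁) (twice-B₋-chain-top c₁ (f z) z∼t₁) of λ ()
    two-on-one-side (inj₂ (inj₂ z∼t₂)) =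
      case from (f-emb z t₂) (twice-B₋-chain-top c₂ (f z) z∼t₂) of λ ()

B₋₋-chain : (c : Chain (suc j) ≼ B₋₋ (suc (suc j))) →
            ∣ proj₁ (proj₁ c zero) ∣ ≤ 1 × ∣ ∁ (proj₁ (proj₁ c (fromℕ j))) ∣ ≤ 1
B₋₋-chain {j} c = +-cancelʳ-≤ j _ 1 (≤-trans bot+j≤top top≤1+j) , (begin
  ∣ ∁ top ∣               ≡⟨ ∣∁p∣≡n∸∣p∣ top ⟩
  suc (suc j) ∸ ∣ top ∣   ≤⟨ ∸-monoʳ-≤ (suc (suc j)) 1+j≤top ⟩
  suc (suc j) ∸ suc j     ≡⟨ m+n∸n≡m 1 (suc j) ⟩
  1                       ∎)
  where
  open ≤-Reasoning
  bot top : Subset (suc (suc j))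
  bot = proj₁ (proj₁ c zero)
  top = proj₁ (proj₁ c (fromℕ j))
  bot+j≤top : ∣ bot ∣ + j ≤ ∣ top ∣
  bot+j≤top = chain-∣∣ (proj₁-strictlyMonotone (Proper {suc (suc j)})) c
  top≤1+j : ∣ top ∣ ≤ suc j
  top≤1+j = ≤-pred (≤∧≢⇒< (∣p∣≤n top) (proj₂ (proj₂ (proj₁ c (fromℕ j))) ∘ ∣p∣≡n⇒p≡⊤))
  1+j≤top : suc j ≤ ∣ top ∣
  1+j≤top = ≤-trans (+-monoˡ-≤ j (Nonempty⇒1≤∣∣ (proj₁ (proj₂ (proj₁ c zero))))) bot+j≤top

B₋₋-free : Free ((Chain (suc j) ⊕ Chain (suc j)) ⊕ Chain 1) (B₋₋ (suc (suc j)))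
B₋₋-free {j} emb@(f , f-emb) = b₂⊈z b₂⊆z
  where
  t₁ b₂ z : Subset (suc (suc j))
  t₁ = proj₁ (f (inj₁ (inj₁ (fromℕ j))))
  b₂ = proj₁ (f (inj₁ (inj₂ zero)))
  z  = proj₁ (f (inj₂ zero))
  z⊈t₁ : ¬ z ⊆ t₁
  z⊈t₁ z⊆t₁ = case from (f-emb _ _) z⊆t₁ of λ ()
  b₂⊈t₁ : ¬ b₂ ⊆ t₁
  b₂⊈t₁ b₂⊆t₁ = case from (f-emb _ _) b₂⊆t₁ of λ { (⊎.inj₁ ()) }
  b₂⊈z : ¬ b₂ ⊆ z
  b₂⊈z b₂⊆z = case from (f-emb _ _) b₂⊆z of λ ()
  -- ∁ t₁ is one point, which z and b₂ both contain, and b₂ is a singleton.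
  b₂⊆z : b₂ ⊆ z
  b₂⊆z w∈b₂ =
    let x , x∈z , x∉t₁  = ⊈⇒∃∉ z⊈t₁
        y , y∈b₂ , y∉t₁ = ⊈⇒∃∉ b₂⊈t₁
        ∣∁t₁∣≤1 = proj₂ (B₋₋-chain (first-chain {P = B₋₋ (suc (suc j))} emb))
        ∣b₂∣≤1  = proj₁ (B₋₋-chain (second-chain {P = B₋₋ (suc (suc j))} emb))
    in subst (_∈ z) (trans (∣∣≤1⇒≡ ∣∁t₁∣≤1 (x∉p⇒x∈∁p x∉t₁) (x∉p⇒x∈∁p y∉t₁))
                           (∣∣≤1⇒≡ ∣b₂∣≤1 y∈b₂ w∈b₂)) x∈z

-- [n] = [1,k] ∪ [k+1,2k-1] ∪ [2k,n], with blocks of sizes k = suc j, j and n ∸ 2k + 1 = suc r.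
module Blocks (j r : ℕ) where

  k : ℕ
  k = suc j

  N : ℕ
  N = k + (j + suc r)

  layout : Subset k → Subset j → Subset (suc r) → Subset N
  layout X Y Z = X ++ (Y ++ Z)

  layout-view : (A : Subset N) → Σ (Subset k) λ X → ∃₂ λ Y Z → A ≡ layout X Y Z
  layout-view A with splitAt k A
  ... | X , W , refl with splitAt j W
  ... | Y , Z , refl = X , Y , Z , refl

  layout-⊆⇔ : ∀ X Y Z X′ Y′ Z′ → layout X Y Z ⊆ layout X′ Y′ Z′ ⇔ (X ⊆ X′ × Y ⊆ Y′ × Z ⊆ Z′)
  layout-⊆⇔ X Y Z X′ Y′ Z′ = mk⇔ (map₂ (to ++-⊆⇔) ∘ to ++-⊆⇔) (from ++-⊆⇔ ∘ map₂ (from ++-⊆⇔))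

  Nonempty-layout : ∀ {X Y Z} → Nonempty (layout X Y Z) → Nonempty X ⊎ Nonempty Y ⊎ Nonempty Z
  Nonempty-layout {X} {Y} = Sum.map₂ (Nonempty-++⁻ Y) ∘ Nonempty-++⁻ X

  ∁-layout : ∀ X Y Z → ∁ (layout X Y Z) ≡ layout (∁ X) (∁ Y) (∁ Z)
  ∁-layout X Y Z = trans (map-++ Bool.not X (Y ++ Z)) (cong (∁ X ++_) (map-++ Bool.not Y Z))

  ∪-layout : ∀ X Y Z X′ Y′ Z′ → layout X Y Z ∪ layout X′ Y′ Z′ ≡ layout (X ∪ X′) (Y ∪ Y′) (Z ∪ Z′)
  ∪-layout X Y Z X′ Y′ Z′ =
    trans (zipWith-++ Bool._∨_ X (Y ++ Z) X′ (Y′ ++ Z′))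
          (cong ((X ∪ X′) ++_) (zipWith-++ Bool._∨_ Y Z Y′ Z′))

  Iv-[1,k] : Iv N 1 k ≡ layout ⊤ ⊥ ⊥
  Iv-[1,k] = trans (Iv-block 0 k (j + suc r)) (cong (⊤ {k} ++_) (replicate-++ j {suc r} false))

  Iv-[k+1,2k-1] : Iv N (suc k) (2 * k ∸ 1) ≡ layout ⊥ ⊤ ⊥
  Iv-[k+1,2k-1] = subst (λ u → Iv N (suc k) u ≡ layout ⊥ ⊤ ⊥) (sym (2k∸1≡k+j j)) (Iv-block k j (suc r))
    where
    -- j + (suc j + 0) is the normal form of 2 * k ∸ 1
    2k∸1≡k+j : ∀ j → j + (suc j + 0) ≡ suc j + j
    2k∸1≡k+j = solve-∀

  extend : Subset (suc k) → Subset N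
  extend (s ∷ X) = layout X (replicate j s) (replicate (suc r) s)

  frame : Subset (suc (suc j)) → Subset N
  frame (s ∷ t ∷ Y) = layout (replicate k s) Y (replicate (suc r) t)

  extend-isOrderEmbedding : IsOrderEmbedding extend
  extend-isOrderEmbedding {s ∷ X} {s′ ∷ X′} = mk⇔ monotone reflecting
    where
    monotone : s ∷ X ⊆ s′ ∷ X′ → extend (s ∷ X) ⊆ extend (s′ ∷ X′)
    monotone sX⊆ = let s≤s′ , X⊆ = to ∷-⊆⇔ sX⊆ in
      from (layout-⊆⇔ X _ _ X′ _ _) (X⊆ , replicate-⊆ s≤s′ , replicate-⊆ s≤s′)
    reflecting : extend (s ∷ X) ⊆ extend (s′ ∷ X′) → s ∷ X ⊆ s′ ∷ X′
    reflecting e⊆ = let X⊆ , _ , Z⊆ = to (layout-⊆⇔ X _ _ X′ _ _) e⊆ in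
      from ∷-⊆⇔ (proj₁ (to ∷-⊆⇔ Z⊆) , X⊆)

  frame-isOrderEmbedding : IsOrderEmbedding frame
  frame-isOrderEmbedding {s ∷ t ∷ Y} {s′ ∷ t′ ∷ Y′} = mk⇔ monotone reflecting
    where
    monotone : s ∷ t ∷ Y ⊆ s′ ∷ t′ ∷ Y′ → frame (s ∷ t ∷ Y) ⊆ frame (s′ ∷ t′ ∷ Y′)
    monotone stY⊆ with to ∷-⊆⇔ stY⊆
    ... | s≤s′ , tY⊆ with to ∷-⊆⇔ tY⊆
    ... | t≤t′ , Y⊆ = from (layout-⊆⇔ _ Y _ _ Y′ _) (replicate-⊆ s≤s′ , Y⊆ , replicate-⊆ t≤t′)
    reflecting : frame (s ∷ t ∷ Y) ⊆ frame (s′ ∷ t′ ∷ Y′) → s ∷ t ∷ Y ⊆ s′ ∷ t′ ∷ Y′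
    reflecting f⊆ with to (layout-⊆⇔ (replicate k s) Y _ (replicate k s′) Y′ _) f⊆
    ... | X⊆ , Y⊆ , Z⊆ = from ∷-⊆⇔ (proj₁ (to ∷-⊆⇔ X⊆) , from ∷-⊆⇔ (proj₁ (to ∷-⊆⇔ Z⊆) , Y⊆))

  𝒜₁-Image : 𝒜₁ N k ≐ Image (extend ∘ (outside ∷_)) Nonempty
  𝒜₁-Image = 𝒜₁⊆ , ⊆𝒜₁
    where
    𝒜₁⊆ : 𝒜₁ N k ⊆ᶠ Image (extend ∘ (outside ∷_)) Nonempty
    𝒜₁⊆ {A} (A≢∅ , A⊆) with layout-view A
    ... | X , Y , Z , refl with to (layout-⊆⇔ X Y Z ⊤ ⊥ ⊥) (subst (layout X Y Z ⊆_) Iv-[1,k] A⊆)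
    ... | _ , Y⊆⊥ , Z⊆⊥ with ⊆⊥⇒≡⊥ {p = Y} Y⊆⊥ | ⊆⊥⇒≡⊥ {p = Z} Z⊆⊥
    ... | refl | refl = X , [ id , ⊥-elim ∘ [ Empty-⊥ , Empty-⊥ ]′ ]′ (Nonempty-layout A≢∅) , refl
    ⊆𝒜₁ : Image (extend ∘ (outside ∷_)) Nonempty ⊆ᶠ 𝒜₁ N k
    ⊆𝒜₁ (X , X≢∅ , refl) =
      Nonempty-++ˡ X≢∅ ,
      subst (layout X ⊥ ⊥ ⊆_) (sym Iv-[1,k]) (from (layout-⊆⇔ X ⊥ ⊥ ⊤ ⊥ ⊥) (⊆⊤ , ⊆-refl , ⊆-refl))

  𝒜₂-Image : 𝒜₂ N k ≐ Image (frame ∘ (outside ∷_) ∘ (outside ∷_)) Nonempty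
  𝒜₂-Image = 𝒜₂⊆ , ⊆𝒜₂
    where
    𝒜₂⊆ : 𝒜₂ N k ⊆ᶠ Image (frame ∘ (outside ∷_) ∘ (outside ∷_)) Nonempty
    𝒜₂⊆ {A} (A≢∅ , A⊆) with layout-view A
    ... | X , Y , Z , refl with to (layout-⊆⇔ X Y Z ⊥ ⊤ ⊥) (subst (layout X Y Z ⊆_) Iv-[k+1,2k-1] A⊆)
    ... | X⊆⊥ , _ , Z⊆⊥ with ⊆⊥⇒≡⊥ {p = X} X⊆⊥ | ⊆⊥⇒≡⊥ {p = Z} Z⊆⊥
    ... | refl | refl =
      Y , [ ⊥-elim ∘ Empty-⊥ , [ id , ⊥-elim ∘ Empty-⊥ ]′ ]′ (Nonempty-layout A≢∅) , refl
    ⊆𝒜₂ : Image (frame ∘ (outside ∷_) ∘ (outside ∷_)) Nonempty ⊆ᶠ 𝒜₂ N k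
    ⊆𝒜₂ (Y , Y≢∅ , refl) =
      Nonempty-++ʳ (⊥ {k}) (Nonempty-++ˡ Y≢∅) ,
      subst (layout ⊥ Y ⊥ ⊆_) (sym Iv-[k+1,2k-1]) (from (layout-⊆⇔ ⊥ Y ⊥ ⊥ ⊤ ⊥) (⊆-refl , ⊆⊤ , ⊆-refl))

  [1,k]∪ : ∀ Y → Iv N 1 k ∪ layout ⊥ Y ⊥ ≡ layout ⊤ Y ⊥
  [1,k]∪ Y = begin
    Iv N 1 k ∪ layout ⊥ Y ⊥          ≡⟨ cong (_∪ layout ⊥ Y ⊥) Iv-[1,k] ⟩
    layout ⊤ ⊥ ⊥ ∪ layout ⊥ Y ⊥      ≡⟨ ∪-layout ⊤ ⊥ ⊥ ⊥ Y ⊥ ⟩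
    layout (⊤ ∪ ⊥) (⊥ ∪ Y) (⊥ ∪ ⊥)   ≡⟨ cong₂ _++_ (∪-zeroˡ (⊥ {k}))
                                            (cong₂ _++_ (∪-identityˡ Y) (∪-identityˡ (⊥ {suc r}))) ⟩
    layout ⊤ Y ⊥                     ∎
    where open ≡-Reasoning

  𝒜₁₂-Image : 𝒜₁₂ N k ≐ Image (frame ∘ (inside ∷_) ∘ (outside ∷_)) Nonempty
  𝒜₁₂-Image = 𝒜₁₂⊆ , ⊆𝒜₁₂
    where
    𝒜₁₂⊆ : 𝒜₁₂ N k ⊆ᶠ Image (frame ∘ (inside ∷_) ∘ (outside ∷_)) Nonempty
    𝒜₁₂⊆ (_ , A∈𝒜₂ , refl) with proj₁ 𝒜₂-Image A∈𝒜₂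
    ... | Y , Y≢∅ , refl = Y , Y≢∅ , [1,k]∪ Y
    ⊆𝒜₁₂ : Image (frame ∘ (inside ∷_) ∘ (outside ∷_)) Nonempty ⊆ᶠ 𝒜₁₂ N k
    ⊆𝒜₁₂ (Y , Y≢∅ , refl) = layout ⊥ Y ⊥ , proj₂ 𝒜₂-Image (Y , Y≢∅ , refl) , sym ([1,k]∪ Y)

  𝒜₁ᶜ-Image : 𝒜₁ N k ᶜ ≐ Image (extend ∘ (inside ∷_)) (_≢ ⊤)
  𝒜₁ᶜ-Image = ᶜ-Image (λ X → trans (∁-layout X ⊥ ⊥) (cong₂ (layout (∁ X)) ∁⊥≡⊤ ∁⊥≡⊤)) 𝒜₁-Image

  𝒜₂ᶜ-Image : 𝒜₂ N k ᶜ ≐ Image (frame ∘ (inside ∷_) ∘ (inside ∷_)) (_≢ ⊤)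
  𝒜₂ᶜ-Image =
    ᶜ-Image (λ Y → trans (∁-layout ⊥ Y ⊥) (cong₂ (λ X Z → layout X (∁ Y) Z) ∁⊥≡⊤ ∁⊥≡⊤)) 𝒜₂-Image

  𝒜₁₂ᶜ-Image : 𝒜₁₂ N k ᶜ ≐ Image (frame ∘ (outside ∷_) ∘ (inside ∷_)) (_≢ ⊤)
  𝒜₁₂ᶜ-Image =
    ᶜ-Image (λ Y → trans (∁-layout ⊤ Y ⊥) (cong₂ (λ X Z → layout X (∁ Y) Z) ∁⊤≡⊥ ∁⊥≡⊤)) 𝒜₁₂-Image

  𝒜₁≅B₋ : FamPoset (𝒜₁ N k) ≅ B₋ k
  𝒜₁≅B₋ = Image-≅ (∘-isOrderEmbedding extend-isOrderEmbedding (∷-isOrderEmbedding outside)) 𝒜₁-Image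

  𝒜₂≅B₋ : FamPoset (𝒜₂ N k) ≅ B₋ j
  𝒜₂≅B₋ = Image-≅ (∘-isOrderEmbedding frame-isOrderEmbedding
                    (∘-isOrderEmbedding (∷-isOrderEmbedding outside) (∷-isOrderEmbedding outside)))
                  𝒜₂-Image

  𝒜₁∪𝒜₁ᶜ≅B₋₋ : FamPoset (𝒜₁ N k ∪F 𝒜₁ N k ᶜ) ≅ B₋₋ (suc k)
  𝒜₁∪𝒜₁ᶜ≅B₋₋ = Image-≅ extend-isOrderEmbedding (∪-Image-Proper 𝒜₁-Image 𝒜₁ᶜ-Image)

  𝒜₂∪𝒜₁₂ᶜ-Image : 𝒜₂ N k ∪F 𝒜₁₂ N k ᶜ ≐ Image (frame ∘ (outside ∷_)) Proper
  𝒜₂∪𝒜₁₂ᶜ-Image = ∪-Image-Proper 𝒜₂-Image 𝒜₁₂ᶜ-Image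

  𝒜₁₂∪𝒜₂ᶜ-Image : 𝒜₁₂ N k ∪F 𝒜₂ N k ᶜ ≐ Image (frame ∘ (inside ∷_)) Proper
  𝒜₁₂∪𝒜₂ᶜ-Image = ∪-Image-Proper 𝒜₁₂-Image 𝒜₂ᶜ-Image

  𝒜₂∪𝒜₁₂ᶜ≅B₋₋ : FamPoset (𝒜₂ N k ∪F 𝒜₁₂ N k ᶜ) ≅ B₋₋ k
  𝒜₂∪𝒜₁₂ᶜ≅B₋₋ =
    Image-≅ (∘-isOrderEmbedding frame-isOrderEmbedding (∷-isOrderEmbedding outside)) 𝒜₂∪𝒜₁₂ᶜ-Image

  -- The first bit of frame records whether [1,k] ⊆ A.  The four families split into the slice
  -- where it is off, which is the family of (5), and the slice 𝒜₁₂ ∪ 𝒜₂ᶜ where it is on.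
  all≼B₋₋ : FamPoset (𝒜₂ N k ∪F 𝒜₁₂ N k ∪F 𝒜₂ N k ᶜ ∪F 𝒜₁₂ N k ᶜ) ≼ B₋₋ (suc k)
  all≼B₋₋ = Image-≼ frame-isOrderEmbedding all⊆
    where
    all⊆ : 𝒜₂ N k ∪F 𝒜₁₂ N k ∪F 𝒜₂ N k ᶜ ∪F 𝒜₁₂ N k ᶜ ⊆ᶠ Image frame Proper
    all⊆ (inj₁ (inj₁ (inj₁ A∈𝒜₂)))   = Image-∷-Proper outside (proj₁ 𝒜₂∪𝒜₁₂ᶜ-Image (inj₁ A∈𝒜₂))
    all⊆ (inj₁ (inj₁ (inj₂ A∈𝒜₁₂)))  = Image-∷-Proper inside  (proj₁ 𝒜₁₂∪𝒜₂ᶜ-Image (inj₁ A∈𝒜₁₂))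
    all⊆ (inj₁ (inj₂ A∈𝒜₂ᶜ))         = Image-∷-Proper inside  (proj₁ 𝒜₁₂∪𝒜₂ᶜ-Image (inj₂ A∈𝒜₂ᶜ))
    all⊆ (inj₂ A∈𝒜₁₂ᶜ)               = Image-∷-Proper outside (proj₁ 𝒜₂∪𝒜₁₂ᶜ-Image (inj₂ A∈𝒜₁₂ᶜ))

2k≤n⇒blocks : ∀ {j n} → 2 * suc j ≤ n → ∃ λ r → suc j + (j + suc r) ≡ n
2k≤n⇒blocks {j} 2k≤n = let r , 2k+r≡n = m≤n⇒∃[o]m+o≡n 2k≤n in r , trans (blocks≡ j r) 2k+r≡n
  where
  blocks≡ : ∀ j r → suc j + (j + suc r) ≡ 2 * suc j + r
  blocks≡ = solve-∀

lemma2p2 : (k n : ℕ) → 1 ≤ k → 2 * k ≤ n →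
    (Free (Chain k ⊕ Chain 1) (B₋ k) × Free ((Chain k ⊕ Chain k) ⊕ Chain 1) (twice (B₋ k)))
    × Free ((Chain k ⊕ Chain k) ⊕ Chain 1) (B₋₋ (suc k))
    × (FamPoset (𝒜₁ n k) ≅ B₋ k
       × FamPoset (𝒜₂ n k) ≅ B₋ (k ∸ 1)
       × FamPoset (𝒜₁ n k ∪F (𝒜₁ n k) ᶜ) ≅ B₋₋ (suc k))
    × FamPoset (𝒜₂ n k ∪F 𝒜₁₂ n k ∪F (𝒜₂ n k) ᶜ ∪F (𝒜₁₂ n k) ᶜ) ≼ B₋₋ (suc k)
    × FamPoset (𝒜₂ n k ∪F (𝒜₁₂ n k) ᶜ) ≅ B₋₋ k
lemma2p2 (suc j) n _ 2k≤n with 2k≤n⇒blocks 2k≤n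
... | r , refl =
  (B₋-free , twice-B₋-free) , B₋₋-free , (𝒜₁≅B₋ , 𝒜₂≅B₋ , 𝒜₁∪𝒜₁ᶜ≅B₋₋) , all≼B₋₋ , 𝒜₂∪𝒜₁₂ᶜ≅B₋₋
  where open Blocks j r
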